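{- Let $\Gamma$ be a finite simplicial complex on $[n]$ whose Stanley–Reisner ideal $I_\Gamma$ is an almost USLI. Then the number of facets of $\Gamma$ is strictly greater than $\mathrm{reg}(I_\Gamma)$.
   Context: $S_{[n]}=\mathbf k[x_1,\ldots,x_n]\subset S=\mathbf k[x_i:i\in\mathbb N]$; $I_\Gamma=\langle\prod_{i\in F}x_i:F\subseteq[n],F\notin\Gamma\rangle$. Monomials are ordered by graded lex: lower degree is larger, equal degrees compared lexicographically with $x_1>x_2>\cdots$. A squarefree monomial ideal $I$ is squarefree strongly stable if for every minimal generator $m$ and every $i<j$ with $x_j\mid m$, $x_i\nmid m$, the monomial $mx_i/x_j$ lies in $I$. A squarefree monomial ideal $I\subset S$ is a squarefree lexsegment ideal of $S$ if for each monomial $m\in I$ and squarefree $m'$ with $\deg m'=\deg m$, $m'>_{\mathrm{lex}}m$, we have $m'\in I$. An ideal $L$ (of $S$ or $S_{[n]}$) is a USLI if it is finitely generated in each degree and $LS$ is a squarefree lexsegment ideal of $S$. A squarefree strongly stable ideal $I$ with minimal generators $m_1>_{\mathrm{lex}}\cdots>_{\mathrm{lex}}m_l>_{\mathrm{lex}}m_{l+1}$ is an almost USLI if $I$ is not a USLI but $\langle m_1,\ldots,m_l\rangle$ is a USLI. $\mathrm{reg}(I)$ is the maximal degree of a minimal generator of $I$. -}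

module Defs where

open import Level using (0ℓ)
open import Data.Nat using (ℕ; _<_; _≤_)
open import Data.List using (List; []; length)
open import Data.List.Relation.Unary.Linked using (Linked; [])
open import Data.List.Relation.Unary.Any using (Any)
open import Data.List.Relation.Unary.AllPairs using (AllPairs)
open import Data.List.Membership.Propositional using (_∈_; _∉_)
open import Data.Product using (Σ; ∃; ∃-syntax; _×_; _,_; proj₁)
open import Data.Sum using (_⊎_)
open import Relation.Nullary using (¬_; Dec)
open import Relation.Binary.PropositionalEquality using (_≡_; _≢_)
open import Function.Bundles using (_⇔_)

-- Variables are indexed from 0: the paper's x_1, x_2, ... are our
-- indices 0, 1, ...; S_[n] uses the variables with index < n.
-- A squarefree monomial is its support, a strictly increasing list.

SqMon : Set
SqMon = Σ (List ℕ) (Linked _<_)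

_∈ᵐ_ : ℕ → SqMon → Set
i ∈ᵐ m = i ∈ proj₁ m

_∉ᵐ_ : ℕ → SqMon → Set
i ∉ᵐ m = i ∉ proj₁ m

deg : SqMon → ℕ
deg m = length (proj₁ m)

_∣ᵐ_ : SqMon → SqMon → Set
u ∣ᵐ v = ∀ i → i ∈ᵐ u → i ∈ᵐ v

_≈ᵐ_ : SqMon → SqMon → Set
u ≈ᵐ v = (u ∣ᵐ v) × (v ∣ᵐ u)

-- u >lex v : at the first variable where the exponents differ, u has the
-- larger exponent (x_0 > x_1 > ...).
_>lex_ : SqMon → SqMon → Set
u >lex v = ∃[ i ] (i ∈ᵐ u × i ∉ᵐ v × (∀ j → j < i → (j ∈ᵐ u ⇔ j ∈ᵐ v)))

_>glex_ : SqMon → SqMon → Set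
u >glex v = (deg u < deg v) ⊎ ((deg u ≡ deg v) × (u >lex v))

-- Squarefree monomial ideals of S, represented by the set of squarefree
-- monomials they contain (which determines a squarefree monomial ideal).

SqIdeal : Set₁
SqIdeal = SqMon → Set

⟨_⟩ : (SqMon → Set) → SqIdeal
⟨ G ⟩ u = ∃[ g ] (G g × (g ∣ᵐ u))

-- minimal monomial generators of I (they are squarefree, and all their
-- divisors are squarefree, so it suffices to look at squarefree monomials)
MinGen : SqIdeal → SqMon → Set
MinGen I m = I m × (∀ v → v ∣ᵐ m → I v → m ∣ᵐ v)

SqStronglyStable : SqIdeal → Set
SqStronglyStable I =
  ∀ m i j → MinGen I m → i < j → j ∈ᵐ m → i ∉ᵐ m →
  ∀ u → (∀ k → k ∈ᵐ u ⇔ ((k ≡ i) ⊎ ((k ∈ᵐ m) × (k ≢ j)))) → I u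

SqLexsegment : SqIdeal → Set
SqLexsegment I = ∀ m m′ → I m → deg m′ ≡ deg m → m′ >lex m → I m′

FinGenInEachDegree : SqIdeal → Set
FinGenInEachDegree I =
  ∀ d → ∃[ gs ] (∀ m → MinGen I m → deg m ≡ d → Any (_≈ᵐ m) gs)

-- USLI (given by the squarefree monomials of its extension L S)
USLI : SqIdeal → Set
USLI I = FinGenInEachDegree I × SqLexsegment I

-- almost USLI: squarefree strongly stable, not a USLI, and, with the
-- minimal generators listed m_1 >glex ... >glex m_l >glex m_{l+1},
-- the ideal ⟨m_1,...,m_l⟩ is a USLI.
AlmostUSLI : SqIdeal → Set
AlmostUSLI I =
  SqStronglyStable I × (¬ USLI I) ×
  (∃[ g ] (MinGen I g
          × (∀ h → MinGen I h → ¬ (h ≈ᵐ g) → h >glex g)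
          × USLI ⟨ (λ h → MinGen I h × ¬ (h ≈ᵐ g)) ⟩))

-- regularity in the paper's sense: maximal degree of a minimal generator
IsReg : SqIdeal → ℕ → Set
IsReg I r = (∃[ g ] (MinGen I g × deg g ≡ r)) × (∀ g → MinGen I g → deg g ≤ r)

-- Finite simplicial complexes on [n] = {0,...,n-1} (faces = supports).

record SimplicialComplex (n : ℕ) : Set₁ where
  field
    Face     : SqMon → Set
    Face-dec : ∀ F → Dec (Face F)
    Face-⊆   : ∀ F → Face F → ∀ i → i ∈ᵐ F → i < n
    empty    : Face ([] , [])
    down     : ∀ F G → G ∣ᵐ F → Face F → Face G

module _ {n : ℕ} (Γ : SimplicialComplex n) where
  open SimplicialComplex Γ

  NonFace : SqMon → Set
  NonFace F = (∀ i → i ∈ᵐ F → i < n) × ¬ Face F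

  SR : SqIdeal
  SR = ⟨ NonFace ⟩

  IsFacet : SqMon → Set
  IsFacet F = Face F × (∀ G → Face G → F ∣ᵐ G → G ∣ᵐ F)

  NumFacets : ℕ → Set
  NumFacets k = ∃[ fs ] ((length fs ≡ k)
                        × AllPairs (λ a b → ¬ (a ≈ᵐ b)) fs
                        × (∀ F → IsFacet F ⇔ Any (_≈ᵐ F) fs))

module Submission where

-- Let g be the glex-last minimal generator of I_Γ. If c_i = x_i ∏_{j ∈ g, j < i} x_j lay in I_Γ for
-- every x_i ∤ g preceding some variable of g, the lexsegment property of the ideal generated by the
-- other generators would pass to I_Γ, and I_Γ would be a USLI. So some c_i is a face of Γ.
-- No two of c_i and the deg g faces g / x_j lie in a common face: two of the g / x_j together
-- contain g, and c_i together with g / x_j contains g (j < i) or, by strong stability,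
-- g x_i / x_j ∈ I_Γ (j > i). These deg g + 1 faces lie in distinct facets, and deg g ≥ reg I_Γ
-- since g is glex-last.

open import Level using (0ℓ)
open import Defs
open import Data.Nat using (ℕ; zero; suc; _<_; _≤_; _≤′_; ≤′-refl; ≤′-step; _≟_; _<?_; s≤s; z≤n)
open import Data.Nat.Properties
open import Data.Fin using (Fin) renaming (zero to fzero; suc to fsuc)
open import Data.Fin.Properties using (injective⇒≤) renaming (_≟_ to _≟ᶠ_)
open import Data.List using (List; []; _∷_; length; lookup; filter; upTo)
open import Data.List.Relation.Unary.Linked using ([])
import Data.List.Relation.Unary.Linked.Properties as Linked
open import Data.List.Relation.Unary.AllPairs using (AllPairs; _∷_)
import Data.List.Relation.Unary.All as All
open import Data.List.Relation.Unary.Any as Any using (Any; here; there)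
open import Data.List.Relation.Unary.Any.Properties using (lookup-index)
open import Data.List.Membership.Propositional using (_∈_; _∉_; find; lose)
open import Data.List.Membership.Propositional.Properties
  using (∈-filter⁺; ∈-filter⁻; ∈-upTo⁺; ∈-upTo⁻; ∈-lookup)
open import Data.List.Membership.DecPropositional _≟_ using (_∈?_)
open import Data.Product using (∃-syntax; _×_; _,_; proj₁; proj₂)
open import Data.Sum using (_⊎_; inj₁; inj₂; [_,_])
open import Data.Empty using (⊥; ⊥-elim)
open import Relation.Nullary using (¬_; Dec; yes; no; ¬?; _×-dec_)
open import Relation.Nullary.Decidable using (decidable-stable)
open import Relation.Binary.Definitions using (tri<; tri≈; tri>)
open import Relation.Unary using (Pred; Decidable; _⊆_)
open import Relation.Unary.Properties using (_∪?_; _∩?_; ∁?)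
open import Relation.Binary.PropositionalEquality using (_≡_; _≢_; refl; sym; cong; subst; module ≡-Reasoning)
open import Function.Bundles using (mk⇔; Equivalence)

sorted : (m : SqMon) → AllPairs _<_ (proj₁ m)
sorted m = Linked.Linked⇒AllPairs <-trans (proj₂ m)

-- Opaque, so that n and P? can be inferred from a type mentioning monomial n P?.
opaque
  monomial : (n : ℕ) {P : Pred ℕ 0ℓ} → Decidable P → SqMon
  monomial n P? = filter P? (upTo n) , Linked.filter⁺ P? <-trans (Linked.applyUpTo⁺₂ (λ i → i) n n<1+n)

opaque
  unfolding monomial

  ∈-monomial⁻ : ∀ {n} {P : Pred ℕ 0ℓ} {P? : Decidable P} {i} → i ∈ᵐ monomial n P? → i < n × P i
  ∈-monomial⁻ {P? = P?} i∈ with i∈upTo , Pi ← ∈-filter⁻ P? i∈ = ∈-upTo⁻ i∈upTo , Pi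

  ∈-monomial⁺ : ∀ {n} {P : Pred ℕ 0ℓ} {P? : Decidable P} {i} → i < n → P i → i ∈ᵐ monomial n P?
  ∈-monomial⁺ {P? = P?} i<n Pi = ∈-filter⁺ P? (∈-upTo⁺ i<n) Pi

monomial-∣ : ∀ {n} {P Q : Pred ℕ 0ℓ} {P? : Decidable P} {Q? : Decidable Q} →
             P ⊆ Q → monomial n P? ∣ᵐ monomial n Q?
monomial-∣ P⊆Q i i∈ with i<n , Pi ← ∈-monomial⁻ i∈ = ∈-monomial⁺ i<n (P⊆Q Pi)

∣ᵐ-refl : ∀ {u} → u ∣ᵐ u
∣ᵐ-refl i i∈u = i∈u

∣ᵐ-trans : ∀ {u v w} → u ∣ᵐ v → v ∣ᵐ w → u ∣ᵐ w
∣ᵐ-trans u∣v v∣w i i∈u = v∣w i (u∣v i i∈u)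

_∣ᵐ?_ : (u v : SqMon) → Dec (u ∣ᵐ v)
u ∣ᵐ? v with All.all? (_∈? proj₁ v) (proj₁ u)
... | yes u⊆v = yes (λ i i∈u → All.lookup u⊆v i∈u)
... | no u⊈v  = no (λ u∣v → u⊈v (All.tabulate (u∣v _)))

_≈ᵐ?_ : (u v : SqMon) → Dec (u ≈ᵐ v)
u ≈ᵐ? v = (u ∣ᵐ? v) ×-dec (v ∣ᵐ? u)

lookup-injective : ∀ {xs} → AllPairs _<_ xs → ∀ {s t} → lookup xs s ≡ lookup xs t → s ≡ t
lookup-injective (_   ∷ _)  {fzero}  {fzero}  _  = refl
lookup-injective (x<_ ∷ _)  {fzero}  {fsuc t} eq = ⊥-elim (<-irrefl eq (All.lookup x<_ (∈-lookup t)))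
lookup-injective (x<_ ∷ _)  {fsuc s} {fzero}  eq = ⊥-elim (<-irrefl (sym eq) (All.lookup x<_ (∈-lookup s)))
lookup-injective (_   ∷ xs) {fsuc s} {fsuc t} eq = cong fsuc (lookup-injective xs eq)

⊆⇒length≤ : ∀ {xs ys : List ℕ} → AllPairs _<_ xs → (∀ {i} → i ∈ xs → i ∈ ys) →
            length xs ≤ length ys
⊆⇒length≤ {xs} {ys} xs-sorted xs⊆ys = injective⇒≤ φ-injective
  where
  φ : Fin (length xs) → Fin (length ys)
  φ t = Any.index (xs⊆ys (∈-lookup t))

  φ-injective : ∀ {s t} → φ s ≡ φ t → s ≡ t
  φ-injective {s} {t} eq = lookup-injective xs-sorted (begin
    lookup xs s      ≡⟨ lookup-index (xs⊆ys (∈-lookup s)) ⟩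
    lookup ys (φ s)  ≡⟨ cong (lookup ys) eq ⟩
    lookup ys (φ t)  ≡⟨ lookup-index (xs⊆ys (∈-lookup t)) ⟨
    lookup xs t      ∎)
    where open ≡-Reasoning

≈ᵐ⇒deg≡ : ∀ {u v} → u ≈ᵐ v → deg u ≡ deg v
≈ᵐ⇒deg≡ {u} {v} (u∣v , v∣u) =
  ≤-antisym (⊆⇒length≤ (sorted u) (u∣v _)) (⊆⇒length≤ (sorted v) (v∣u _))

reg≤deg-last : ∀ {I g r} → (∀ h → MinGen I h → ¬ (h ≈ᵐ g) → h >glex g) → IsReg I r → r ≤ deg g
reg≤deg-last {g = g} g-last ((h , h-gen , refl) , _) with h ≈ᵐ? g
... | yes h≈g = ≤-reflexive (≈ᵐ⇒deg≡ {h} {g} h≈g)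
... | no  h≉g with g-last h h-gen h≉g
...   | inj₁ deg< = <⇒≤ deg<
...   | inj₂ (deg≡ , _) = ≤-reflexive deg≡

Bounded : ℕ → SqMon → Set
Bounded n m = ∀ i → i ∈ᵐ m → i < n

monomial-bounded : ∀ {n} {P : Pred ℕ 0ℓ} {P? : Decidable P} → Bounded n (monomial n P?)
monomial-bounded i i∈ = proj₁ (∈-monomial⁻ i∈)

module MaximalExtension (n : ℕ) (Good : SqMon → Set) (good? : ∀ m → Dec (Good m))
                        (Good-∣ : ∀ {u v} → u ∣ᵐ v → Good v → Good u) where

  insert : ℕ → SqMon → SqMon
  insert x m = monomial n ((_∈? proj₁ m) ∪? (_≟ x))

  ∣-insert : ∀ {x m} → Bounded n m → m ∣ᵐ insert x m
  ∣-insert m-bounded i i∈m = ∈-monomial⁺ (m-bounded i i∈m) (inj₁ i∈m)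

  insert-∣ : ∀ {x u v} → u ∣ᵐ v → insert x u ∣ᵐ insert x v
  insert-∣ u∣v = monomial-∣ λ { (inj₁ i∈u) → inj₁ (u∣v _ i∈u) ; (inj₂ i≡x) → inj₂ i≡x }

  step : ℕ → SqMon → SqMon
  step x m with good? (insert x m)
  ... | yes _ = insert x m
  ... | no  _ = m

  step-good : ∀ x {m} → Good m → Good (step x m)
  step-good x {m} m-good with good? (insert x m)
  ... | yes good = good
  ... | no  _    = m-good

  step-bounded : ∀ x {m} → Bounded n m → Bounded n (step x m)
  step-bounded x {m} m-bounded with good? (insert x m)
  ... | yes _ = monomial-bounded
  ... | no  _ = m-bounded

  ∣-step : ∀ x {m} → Bounded n m → m ∣ᵐ step x m
  ∣-step x {m} m-bounded with good? (insert x m)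
  ... | yes _ = ∣-insert {x} {m} m-bounded
  ... | no  _ = ∣ᵐ-refl {m}

  step-rejects : ∀ {x m} → x < n → x ∉ᵐ step x m → ¬ Good (insert x m)
  step-rejects {x} {m} x<n x∉ with good? (insert x m)
  ... | yes _   = λ _ → x∉ (∈-monomial⁺ x<n (inj₂ refl))
  ... | no  bad = bad

  module _ (S : SqMon) (S-bounded : Bounded n S) (S-good : Good S) where

    stage : ℕ → SqMon
    stage zero    = S
    stage (suc x) = step x (stage x)

    stage-good : ∀ k → Good (stage k)
    stage-good zero    = S-good
    stage-good (suc k) = step-good k (stage-good k)

    stage-bounded : ∀ k → Bounded n (stage k)
    stage-bounded zero    = S-bounded
    stage-bounded (suc k) = step-bounded k (stage-bounded k)

    stage-∣ : ∀ {k l} → k ≤′ l → stage k ∣ᵐ stage l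
    stage-∣ {k} ≤′-refl = ∣ᵐ-refl {stage k}
    stage-∣ {k} {suc l} (≤′-step k≤l) =
      ∣ᵐ-trans {stage k} {stage l} {stage (suc l)} (stage-∣ k≤l) (∣-step l (stage-bounded l))

    maximal : ∃[ R ] (Good R × S ∣ᵐ R × (∀ x → x < n → x ∉ᵐ R → ¬ Good (insert x R)))
    maximal = stage n , stage-good n , stage-∣ {l = n} (≤⇒≤′ z≤n) , stage-n-maximal
      where
      -- x was rejected when it was considered, against the smaller monomial stage x.
      stage-n-maximal : ∀ x → x < n → x ∉ᵐ stage n → ¬ Good (insert x (stage n))
      stage-n-maximal x x<n x∉ good =
        step-rejects x<n (λ x∈ → x∉ (stage-∣ {l = n} (≤⇒≤′ x<n) x x∈))
          (Good-∣ (insert-∣ {x} {stage x} {stage n} (stage-∣ {l = n} (≤⇒≤′ (<⇒≤ x<n)))) good)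

module StanleyReisner {n : ℕ} (Γ : SimplicialComplex n) where
  open SimplicialComplex Γ

  SR-∣ : ∀ {u v} → SR Γ u → u ∣ᵐ v → SR Γ v
  SR-∣ {u} {v} (N , N-nonface , N∣u) u∣v = N , N-nonface , ∣ᵐ-trans {N} {u} {v} N∣u u∣v

  SR-nonFace : ∀ {u} → SR Γ u → ¬ Face u
  SR-nonFace {u} (N , (_ , N∉Γ) , N∣u) u∈Γ = N∉Γ (down u N N∣u u∈Γ)

  nonFace⇒SR : ∀ {u} → Bounded n u → ¬ Face u → SR Γ u
  nonFace⇒SR {u} u-bounded u∉Γ = u , (u-bounded , u∉Γ) , ∣ᵐ-refl {u}

  MinGen-bounded : ∀ {g} → MinGen (SR Γ) g → Bounded n g
  MinGen-bounded ((N , (N-bounded , N∉Γ) , N∣g) , g-min) i i∈g =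
    N-bounded i (g-min N N∣g (nonFace⇒SR N-bounded N∉Γ) i i∈g)

  module FaceExtension = MaximalExtension n Face Face-dec (λ {u} {v} u∣v → down v u u∣v)

  facet-above : ∀ {F} → Face F → ∃[ G ] (IsFacet Γ G × F ∣ᵐ G)
  facet-above {F} F∈Γ with FaceExtension.maximal F (Face-⊆ F F∈Γ) F∈Γ
  ... | G , G∈Γ , F∣G , G-maximal = G , (G∈Γ , G-facet) , F∣G
    where
    open FaceExtension using (insert)

    G-facet : ∀ H → Face H → G ∣ᵐ H → H ∣ᵐ G
    G-facet H H∈Γ G∣H x x∈H with x ∈? proj₁ G
    ... | yes x∈G = x∈G
    ... | no  x∉G = ⊥-elim (G-maximal x x<n x∉G (down H (insert x G) insert∣H H∈Γ))
      where
      x<n : x < n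
      x<n = Face-⊆ H H∈Γ x x∈H

      insert∣H : insert x G ∣ᵐ H
      insert∣H y y∈ with ∈-monomial⁻ y∈
      ... | _ , inj₁ y∈G  = G∣H y y∈G
      ... | _ , inj₂ refl = x∈H

  module Removal (N : SqMon) where

    infix 30 N∖_
    N∖_ : SqMon → SqMon
    N∖ R = monomial n ((_∈? proj₁ N) ∩? ∁? (_∈? proj₁ R))

    N∖-antitone : ∀ {R R′} → R ∣ᵐ R′ → N∖ R′ ∣ᵐ N∖ R
    N∖-antitone R∣R′ = monomial-∣ λ (i∈N , i∉R′) → i∈N , λ i∈R → i∉R′ (R∣R′ _ i∈R)

    open MaximalExtension n (λ R → ¬ Face (N∖ R)) (λ R → ¬? (Face-dec (N∖ R)))
      (λ {R} {R′} R∣R′ N∖R′∉Γ N∖R∈Γ → N∖R′∉Γ (down (N∖ R) (N∖ R′) (N∖-antitone {R} {R′} R∣R′) N∖R∈Γ))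
      public

  minGen-below : ∀ {u} → SR Γ u → ∃[ M ] (MinGen (SR Γ) M × M ∣ᵐ u)
  minGen-below {u} (N , (N-bounded , N∉Γ) , N∣u) with Removal.maximal N ([] , []) (λ _ ()) N∖∅∉Γ
    where
    N∖∅∉Γ : ¬ Face (Removal.N∖_ N ([] , []))
    N∖∅∉Γ N∖∅∈Γ = N∉Γ (down _ N (λ i i∈N → ∈-monomial⁺ (N-bounded i i∈N) (i∈N , λ ())) N∖∅∈Γ)
  ... | R , N∖R∉Γ , _ , R-maximal =
    N∖ R , (nonFace⇒SR monomial-bounded N∖R∉Γ , N∖R-minimal) , ∣ᵐ-trans {N∖ R} {N} {u} N∖R∣N N∣u
    where
    open Removal N

    N∖R∣N : N∖ R ∣ᵐ N
    N∖R∣N i i∈ = proj₁ (proj₂ (∈-monomial⁻ i∈))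

    N∖R-minimal : ∀ v → v ∣ᵐ N∖ R → SR Γ v → N∖ R ∣ᵐ v
    N∖R-minimal v v∣N∖R v∈SR x x∈N∖R with x ∈? proj₁ v
    ... | yes x∈v = x∈v
    ... | no  x∉v with x<n , x∈N , x∉R ← ∈-monomial⁻ x∈N∖R =
      ⊥-elim (R-maximal x x<n x∉R (SR-nonFace (SR-∣ {v} {N∖ insert x R} v∈SR v∣N∖insert)))
      where
      v∣N∖insert : v ∣ᵐ N∖ insert x R
      v∣N∖insert y y∈v with y<n , y∈N , y∉R ← ∈-monomial⁻ (v∣N∖R y y∈v) =
        ∈-monomial⁺ y<n (y∈N , λ y∈ → [ y∉R , (λ { refl → x∉v y∈v }) ] (proj₂ (∈-monomial⁻ y∈)))

  NoCommonFace : SqMon → SqMon → Set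
  NoCommonFace F G = ∀ H → Face H → F ∣ᵐ H → G ∣ᵐ H → ⊥

  SR⇒noCommonFace : ∀ {w F G} → SR Γ w → (∀ i → i ∈ᵐ w → i ∈ᵐ F ⊎ i ∈ᵐ G) → NoCommonFace F G
  SR⇒noCommonFace {w} w∈SR w⊆F∪G H H∈Γ F∣H G∣H = SR-nonFace (SR-∣ {w} {H} w∈SR w∣H) H∈Γ
    where
    w∣H : w ∣ᵐ H
    w∣H i i∈w = [ F∣H i , G∣H i ] (w⊆F∪G i i∈w)

  NoCommonFace-sym : ∀ {F G} → NoCommonFace F G → NoCommonFace G F
  NoCommonFace-sym separated H H∈Γ G∣H F∣H = separated H H∈Γ F∣H G∣H

  ≤numFacets : ∀ {m k} (F : Fin m → SqMon) → (∀ a → Face (F a)) →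
               (∀ {a b} → a ≢ b → NoCommonFace (F a) (F b)) → NumFacets Γ k → m ≤ k
  ≤numFacets F F∈Γ separated (facets , refl , _ , facets-complete) = injective⇒≤ φ-injective
    where
    G : Fin _ → SqMon
    G a = proj₁ (facet-above (F∈Γ a))

    G-facet : ∀ a → IsFacet Γ (G a)
    G-facet a = proj₁ (proj₂ (facet-above (F∈Γ a)))

    F∣G : ∀ a → F a ∣ᵐ G a
    F∣G a = proj₂ (proj₂ (facet-above (F∈Γ a)))

    G∈facets : ∀ a → Any (_≈ᵐ G a) facets
    G∈facets a = Equivalence.to (facets-complete (G a)) (G-facet a)

    φ : Fin _ → Fin (length facets)
    φ a = Any.index (G∈facets a)

    φ-injective : ∀ {a b} → φ a ≡ φ b → a ≡ b
    φ-injective {a} {b} φa≡φb with a ≟ᶠ b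
    ... | yes a≡b = a≡b
    ... | no  a≢b = ⊥-elim (separated a≢b (G a) (proj₁ (G-facet a)) (F∣G a) Fb∣Ga)
      where
      -- F b ∣ G b ∣ lookup facets (φ b) = lookup facets (φ a) ∣ G a
      Fb∣Ga : F b ∣ᵐ G a
      Fb∣Ga i i∈Fb = proj₁ (lookup-index (G∈facets a)) i
        (subst (λ t → i ∈ᵐ lookup facets t) (sym φa≡φb) (proj₂ (lookup-index (G∈facets b)) i (F∣G b i i∈Fb)))

  module LastGenerator {g : SqMon} (g-gen : MinGen (SR Γ) g) where

    g-bounded : Bounded n g
    g-bounded = MinGen-bounded {g} g-gen

    -- c_i = x_i ∏_{j ∈ g, j < i} x_j,  g / x_j  and  g x_i / x_j
    cut : ℕ → SqMon
    cut i = monomial n ((_≟ i) ∪? ((_∈? proj₁ g) ∩? (_<? i)))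

    omit : ℕ → SqMon
    omit j = monomial n ((_∈? proj₁ g) ∩? ∁? (_≟ j))

    exchange : ℕ → ℕ → SqMon
    exchange i j = monomial n ((_≟ i) ∪? ((_∈? proj₁ g) ∩? ∁? (_≟ j)))

    ∈-omit⁺ : ∀ {j y} → y ∈ᵐ g → y ≢ j → y ∈ᵐ omit j
    ∈-omit⁺ y∈g y≢j = ∈-monomial⁺ (g-bounded _ y∈g) (y∈g , y≢j)

    omit-face : ∀ {j} → j ∈ᵐ g → Face (omit j)
    omit-face {j} j∈g = decidable-stable (Face-dec (omit j)) λ omit∉Γ →
      proj₂ (proj₂ (∈-monomial⁻ (g-minimal (omit j) omit∣g (nonFace⇒SR monomial-bounded omit∉Γ) j j∈g))) refl
      where
      g-minimal : ∀ v → v ∣ᵐ g → SR Γ v → g ∣ᵐ v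
      g-minimal = proj₂ g-gen

      omit∣g : omit j ∣ᵐ g
      omit∣g y y∈ = proj₁ (proj₂ (∈-monomial⁻ y∈))

    exchange∈SR : SqStronglyStable (SR Γ) → ∀ {i j} → i < n → i < j → j ∈ᵐ g → i ∉ᵐ g →
                  SR Γ (exchange i j)
    exchange∈SR stable {i} {j} i<n i<j j∈g i∉g =
      stable g i j g-gen i<j j∈g i∉g (exchange i j) λ k → mk⇔ (λ k∈ → proj₂ (∈-monomial⁻ k∈)) exchange⁺
      where
      exchange⁺ : ∀ {k} → (k ≡ i) ⊎ (k ∈ᵐ g × k ≢ j) → k ∈ᵐ exchange i j
      exchange⁺ (inj₁ refl)           = ∈-monomial⁺ i<n (inj₁ refl)
      exchange⁺ (inj₂ (k∈g , k≢j)) = ∈-monomial⁺ (g-bounded _ k∈g) (inj₂ (k∈g , k≢j))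

    omit-separated : ∀ {j j′} → j ≢ j′ → NoCommonFace (omit j) (omit j′)
    omit-separated {j} {j′} j≢j′ = SR⇒noCommonFace {g} {omit j} {omit j′} (proj₁ g-gen) g⊆
      where
      g⊆ : ∀ y → y ∈ᵐ g → y ∈ᵐ omit j ⊎ y ∈ᵐ omit j′
      g⊆ y y∈g with y ≟ j
      ... | yes refl = inj₂ (∈-omit⁺ y∈g j≢j′)
      ... | no  y≢j  = inj₁ (∈-omit⁺ y∈g y≢j)

    cut-omit-separated : SqStronglyStable (SR Γ) → ∀ {i j} → i < n → i ∉ᵐ g → j ∈ᵐ g →
                         NoCommonFace (cut i) (omit j)
    cut-omit-separated stable {i} {j} i<n i∉g j∈g with <-cmp j i
    ... | tri≈ _ refl _ = ⊥-elim (i∉g j∈g)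
    ... | tri< j<i _ _ = SR⇒noCommonFace {g} {cut i} {omit j} (proj₁ g-gen) g⊆
      where
      g⊆ : ∀ y → y ∈ᵐ g → y ∈ᵐ cut i ⊎ y ∈ᵐ omit j
      g⊆ y y∈g with y ≟ j
      ... | yes refl = inj₁ (∈-monomial⁺ (g-bounded y y∈g) (inj₂ (y∈g , j<i)))
      ... | no  y≢j  = inj₂ (∈-omit⁺ y∈g y≢j)
    ... | tri> _ _ i<j =
      SR⇒noCommonFace {exchange i j} {cut i} {omit j} (exchange∈SR stable i<n i<j j∈g i∉g) exchange⊆
      where
      exchange⊆ : ∀ y → y ∈ᵐ exchange i j → y ∈ᵐ cut i ⊎ y ∈ᵐ omit j
      exchange⊆ y y∈ with ∈-monomial⁻ y∈
      ... | y<n , inj₁ refl          = inj₁ (∈-monomial⁺ y<n (inj₁ refl))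
      ... | y<n , inj₂ (y∈g , y≢j) = inj₂ (∈-monomial⁺ y<n (y∈g , y≢j))

    deg<numFacets : SqStronglyStable (SR Γ) → ∀ {i k} → i < n → i ∉ᵐ g → Face (cut i) →
                    NumFacets Γ k → deg g < k
    deg<numFacets stable {i} i<n i∉g cut∈Γ = ≤numFacets F F∈Γ separated
      where
      F : Fin (suc (deg g)) → SqMon
      F fzero    = cut i
      F (fsuc t) = omit (lookup (proj₁ g) t)

      F∈Γ : ∀ a → Face (F a)
      F∈Γ fzero    = cut∈Γ
      F∈Γ (fsuc t) = omit-face (∈-lookup t)

      separated : ∀ {a b} → a ≢ b → NoCommonFace (F a) (F b)
      separated {fzero}  {fzero}  0≢0 = ⊥-elim (0≢0 refl)
      separated {fzero}  {fsuc t} _   = cut-omit-separated stable i<n i∉g (∈-lookup t)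
      separated {fsuc t} {fzero}  _   =
        NoCommonFace-sym {cut i} {F (fsuc t)} (cut-omit-separated stable i<n i∉g (∈-lookup t))
      separated {fsuc s} {fsuc t} s≢t =
        omit-separated λ eq → s≢t (cong fsuc (lookup-injective (sorted g) eq))

    OtherGenerator : SqMon → Set
    OtherGenerator h = MinGen (SR Γ) h × ¬ (h ≈ᵐ g)

    ⟨OtherGenerator⟩⊆SR : ∀ {u} → ⟨ OtherGenerator ⟩ u → SR Γ u
    ⟨OtherGenerator⟩⊆SR {u} (h , (h-gen , _) , h∣u) = SR-∣ {h} {u} (proj₁ h-gen) h∣u

    otherGenerator-minGen : ∀ {h} → MinGen (SR Γ) h → ¬ (h ≈ᵐ g) → MinGen ⟨ OtherGenerator ⟩ h
    otherGenerator-minGen {h} h-gen h≉g =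
      (h , (h-gen , h≉g) , ∣ᵐ-refl {h}) , λ v v∣h v∈ → proj₂ h-gen v v∣h (⟨OtherGenerator⟩⊆SR {v} v∈)

    finGen-with-g : FinGenInEachDegree ⟨ OtherGenerator ⟩ → FinGenInEachDegree (SR Γ)
    finGen-with-g others-finGen d with hs , hs-complete ← others-finGen d = g ∷ hs , g∷hs-complete
      where
      g∷hs-complete : ∀ m → MinGen (SR Γ) m → deg m ≡ d → Any (_≈ᵐ m) (g ∷ hs)
      g∷hs-complete m m-gen deg≡ with g ≈ᵐ? m
      ... | yes g≈m = here g≈m
      ... | no  g≉m =
        there (hs-complete m (otherGenerator-minGen {m} m-gen λ (m∣g , g∣m) → g≉m (g∣m , m∣g)) deg≡)

    CutsInSR : Set
    CutsInSR = ∀ i → i ∉ᵐ g → Any (i <_) (proj₁ g) → SR Γ (cut i)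

    lexsegment-with-g : SqLexsegment ⟨ OtherGenerator ⟩ → CutsInSR → SqLexsegment (SR Γ)
    lexsegment-with-g others-lex cuts∈SR m m′ m∈SR deg≡ m′>m@(i , i∈m′ , i∉m , agree)
      with h , h-gen , h∣m ← minGen-below {m} m∈SR | h ≈ᵐ? g
    ... | no h≉g = ⟨OtherGenerator⟩⊆SR {m′} (others-lex m m′ (h , (h-gen , h≉g) , h∣m) deg≡ m′>m)
    ... | yes (_ , g∣h) with Any.any? (i <?_) (proj₁ g) | ∣ᵐ-trans {g} {h} {m} g∣h h∣m
    ...   | yes i<g | g∣m = SR-∣ {cut i} {m′} (cuts∈SR i i∉g i<g) cut∣m′
      where
      i∉g : i ∉ᵐ g
      i∉g i∈g = i∉m (g∣m i i∈g)
      cut∣m′ : cut i ∣ᵐ m′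
      cut∣m′ y y∈ with ∈-monomial⁻ y∈
      ... | _ , inj₁ refl        = i∈m′
      ... | _ , inj₂ (y∈g , y<i) = Equivalence.from (agree y y<i) (g∣m y y∈g)
    ...   | no  i≮g | g∣m = SR-∣ {g} {m′} (proj₁ g-gen) g∣m′
      where
      g∣m′ : g ∣ᵐ m′
      g∣m′ y y∈g = Equivalence.from (agree y y<i) (g∣m y y∈g)
        where
        y<i : y < i
        y<i = ≤∧≢⇒< (≮⇒≥ λ i<y → i≮g (lose y∈g i<y)) λ { refl → i∉m (g∣m y y∈g) }

    USLI-with-g : USLI ⟨ OtherGenerator ⟩ → CutsInSR → USLI (SR Γ)
    USLI-with-g (others-finGen , others-lex) cuts∈SR =
      finGen-with-g others-finGen , lexsegment-with-g others-lex cuts∈SR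

    faceCut-or-cutsInSR : (∃[ i ] (i < n × i ∉ᵐ g × Face (cut i))) ⊎ CutsInSR
    faceCut-or-cutsInSR with Any.any? (λ i → ¬? (i ∈? proj₁ g) ×-dec Face-dec (cut i)) (upTo n)
    ... | yes found with i , i∈upTo , i∉g , cut∈Γ ← find found = inj₁ (i , ∈-upTo⁻ i∈upTo , i∉g , cut∈Γ)
    ... | no  none = inj₂ λ i i∉g i<g →
      nonFace⇒SR monomial-bounded λ cut∈Γ → none (lose (∈-upTo⁺ (i<n i<g)) (i∉g , cut∈Γ))
      where
      i<n : ∀ {i} → Any (i <_) (proj₁ g) → i < n
      i<n i<g with j , j∈g , i<j ← find i<g = <-trans i<j (g-bounded j j∈g)

lemma4p5 : (n : ℕ) (Γ : SimplicialComplex n) → AlmostUSLI (SR Γ) →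
    (r k : ℕ) → IsReg (SR Γ) r → NumFacets Γ k → r < k
lemma4p5 n Γ (stable , not-USLI , g , g-gen , g-last , others-USLI) r k reg facets =
  [ (λ (i , i<n , i∉g , cut∈Γ) →
        ≤-trans (s≤s (reg≤deg-last {SR Γ} {g} g-last reg)) (deg<numFacets stable i<n i∉g cut∈Γ facets))
  , (λ cuts∈SR → ⊥-elim (not-USLI (USLI-with-g others-USLI cuts∈SR)))
  ] faceCut-or-cutsInSR
  where open StanleyReisner.LastGenerator Γ {g} g-gen
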